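{- Let $G=(V,E)$ be a strongly biconnected directed graph with $n=|V|$. Then the number of edges in the output $G_v=(V,E_v)$ of Algorithm A on input $G$ is at most $3(n-1)$.
   Context: A directed graph is strongly biconnected if it is strongly connected and its underlying undirected graph (obtained by ignoring edge directions) has no articulation point. A strongly biconnected component of a directed graph $D$ is a maximal vertex set $U$ such that the subgraph of $D$ induced by $U$ is strongly biconnected. Algorithm A, on input a strongly biconnected directed graph $G=(V,E)$: (1) select a vertex $v\in V$ and set $E_v=\emptyset$; (2) build a spanning tree $T$ of $G$ rooted at $v$ (all edges directed away from $v$) and add all edges of $T$ to $E_v$; (3) build the reverse graph $G_r=(V,E_r)$ with $E_r=\{(u,w) : (w,u)\in E\}$, construct a spanning tree $T_v$ of $G_r$ rooted at $v$, and for each edge $(u,w)$ of $T_v$ add $(w,u)$ to $E_v$; (4) while the underlying undirected graph of $G_v=(V,E_v)$ is not biconnected: compute the strongly biconnected components of $G_v$, find an edge $(u,w)\in E\setminus E_v$ such that $u$ and $w$ do not belong to the same strongly biconnected component of $G_v$, and add $(u,w)$ to $E_v$. Output $G_v=(V,E_v)$. -}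

module Defs where

open import Data.Nat using (ℕ)
open import Data.Fin using (Fin; _≟_)
open import Data.Bool using (Bool; T; if_then_else_; _∨_; _∧_)
open import Data.List using (map; allFin)
open import Data.Nat.ListAction using (sum)
open import Data.Fin.Subset using (Subset; _∈_; _⊆_; ⊤; _-_)
open import Data.Product using (Σ; ∃; ∃-syntax; _×_)
open import Data.Sum using (_⊎_)
open import Relation.Binary.PropositionalEquality using (_≡_; _≢_)
open import Relation.Nullary using (¬_)
open import Relation.Nullary.Decidable using (isYes)

EdgeSet : ℕ → Set
EdgeSet n = Fin n → Fin n → Bool

module _ {n : ℕ} where

  data DPath (S : EdgeSet n) (U : Subset n) : Fin n → Fin n → Set where
    here : ∀ {u} → u ∈ U → DPath S U u u
    step : ∀ {u w x} → u ∈ U → T (S u w) → DPath S U w x → DPath S U u x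

  data UPath (S : EdgeSet n) (U : Subset n) : Fin n → Fin n → Set where
    here : ∀ {u} → u ∈ U → UPath S U u u
    step : ∀ {u w x} → u ∈ U → (T (S u w) ⊎ T (S w u)) → UPath S U w x → UPath S U u x

  StronglyConnectedOn : EdgeSet n → Subset n → Set
  StronglyConnectedOn S U = ∀ u w → u ∈ U → w ∈ U → DPath S U u w

  UConnectedOn : EdgeSet n → Subset n → Set
  UConnectedOn S U = ∀ u w → u ∈ U → w ∈ U → UPath S U u w

  ArticulationPoint : EdgeSet n → Subset n → Fin n → Set
  ArticulationPoint S U x =
    x ∈ U × (∃[ y ] ∃[ z ] (y ∈ (U - x) × z ∈ (U - x) × UPath S U y z × ¬ UPath S (U - x) y z))

  BiconnectedUnderlyingOn : EdgeSet n → Subset n → Set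
  BiconnectedUnderlyingOn S U = UConnectedOn S U × (∀ x → ¬ ArticulationPoint S U x)

  StronglyBiconnectedOn : EdgeSet n → Subset n → Set
  StronglyBiconnectedOn S U = StronglyConnectedOn S U × (∀ x → ¬ ArticulationPoint S U x)

  StronglyBiconnected : EdgeSet n → Set
  StronglyBiconnected S = StronglyBiconnectedOn S ⊤

  BiconnectedUnderlying : EdgeSet n → Set
  BiconnectedUnderlying S = BiconnectedUnderlyingOn S ⊤

  SBComponent : EdgeSet n → Subset n → Set
  SBComponent S U = StronglyBiconnectedOn S U × (∀ U' → U ⊆ U' → StronglyBiconnectedOn S U' → U' ⊆ U)

  SameSBComponent : EdgeSet n → Fin n → Fin n → Set
  SameSBComponent S u w = ∃[ U ] (SBComponent S U × u ∈ U × w ∈ U)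

  record SpanningTree (S : EdgeSet n) (v : Fin n) (Tr : EdgeSet n) : Set where
    field
      subgraph : ∀ u w → T (Tr u w) → T (S u w)
      rootNoIn : ∀ u → ¬ T (Tr u v)
      uniqueIn : ∀ w → w ≢ v → ∃[ u ] (T (Tr u w) × (∀ u' → T (Tr u' w) → u' ≡ u))
      spanning : ∀ w → DPath Tr ⊤ v w

  reverse : EdgeSet n → EdgeSet n
  reverse S u w = S w u

  -- E_v after steps (2),(3): edges of T plus reversals of edges of T_v
  initialEv : EdgeSet n → EdgeSet n → EdgeSet n
  initialEv Tr Tv a b = Tr a b ∨ Tv b a

  addEdge : EdgeSet n → Fin n → Fin n → EdgeSet n
  addEdge S u w a b = S a b ∨ (isYes (a ≟ u) ∧ isYes (b ≟ w))

  -- step (4): Loop E S S' : starting the while-loop with current E_v = S,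
  -- one possible execution terminates with E_v = S'
  data Loop (E : EdgeSet n) : EdgeSet n → EdgeSet n → Set where
    done : ∀ {S} → BiconnectedUnderlying S → Loop E S S
    next : ∀ {S S' u w} → ¬ BiconnectedUnderlying S → T (E u w) → ¬ T (S u w) →
           ¬ SameSBComponent S u w → Loop E (addEdge S u w) S' → Loop E S S'

  AlgorithmAOutput : EdgeSet n → EdgeSet n → Set
  AlgorithmAOutput E Ev =
    ∃[ v ] ∃[ Tr ] ∃[ Tv ] (SpanningTree E v Tr × SpanningTree (reverse E) v Tv × Loop E (initialEv Tr Tv) Ev)

  edgeCount : EdgeSet n → ℕ
  edgeCount S = sum (map (λ u → sum (map (λ w → if S u w then 1 else 0) (allFin n))) (allFin n))

-- The initial graph has at most 2(n − 1) arcs, so it suffices that the loop runs at most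
-- n − 1 times. Call the tree arcs into y₁ and y₂ equivalent when one strongly biconnected
-- vertex set contains both; with the root as a class of its own there are between 1 and n
-- classes. In a graph containing both trees every arc lies in a strongly biconnected set
-- together with some tree arc: take the arc, the tree paths to its ends from the point where
-- the two root paths split, and a path back to that point. When the loop adds (u, w), follow a
-- simple path from w to u. If consecutive arcs always fall into the same class, their sets glue
-- into one containing u and w, which the loop's guard excludes; otherwise the cycle closed by
-- (u, w) glues two different classes together. So each iteration lowers the number of classes.
-- The argument is classical; it runs in the double-negation monad, which suffices because the
-- final inequality is decidable.

module Submission where

open import Algebra.Properties.CommutativeMonoid.Sum as Sum using ()
open import Data.Bool using (Bool; true; false; T; if_then_else_; _∨_; _∧_)
open import Data.Bool.Properties using (T-∨; T-∧)
open import Data.Empty using (⊥-elim)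
open import Data.Fin using (Fin; _≟_; toℕ) renaming (zero to fzero; suc to fsuc)
open import Data.Fin.Properties using (toℕ<n; toℕ-injective)
open import Data.Fin.Subset using (Subset; ∣_∣; inside; outside; _-_; _─_; ⁅_⁆)
  renaming (_∈_ to _∈ₛ_; _∉_ to _∉ₛ_; _⊆_ to _⊆ₛ_; _⊂_ to _⊂ₛ_)
open import Data.Fin.Subset.Properties
  using (_∈?_; p─q⊆p; x∈p∧x≢y⇒x∈p-y; x∈⁅x⁆; p⊂q⇒∣p∣<∣q∣; ∣p∣≤n; x∈p⇒∣p-x∣<∣p∣)
open import Data.List using (List; []; _∷_; map; allFin; tabulate)
open import Data.List.Membership.Propositional using () renaming (_∈_ to _∈ₗ_)
open import Data.List.Properties using (map-tabulate; map-cong)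
open import Data.List.Relation.Unary.All using ([]; lookup)
open import Data.List.Relation.Unary.All.Properties using (¬Any⇒All¬)
open import Data.List.Relation.Unary.AllPairs using ([]; _∷_)
open import Data.List.Relation.Unary.Any using (here; there; any?)
open import Data.List.Relation.Unary.Unique.Propositional using (Unique)
open import Data.Nat using (ℕ; zero; suc; _+_; _*_; _∸_; _≤_; _<_; _≤?_; z≤n; s≤s)
open import Data.Nat.ListAction as List using ()
open import Data.Nat.Properties
  using (+-0-commutativeMonoid; +-comm; +-assoc; +-identityʳ; +-mono-≤; +-monoˡ-≤; +-monoʳ-≤; ≤-refl; ≤-reflexive;
         ≤-trans; ≤-pred; <-≤-trans; <-cmp; <⇒≱; ∸-monoʳ-<; m∸n≤m; m+n≤o⇒m≤o∸n; module ≤-Reasoning)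
open import Data.Nat.Tactic.RingSolver using (solve-∀)
open import Data.Product using (Σ-syntax; ∃-syntax; _×_; _,_; proj₁; proj₂)
open import Data.Sum using (_⊎_; inj₁; inj₂)
open import Data.Unit using (tt)
open import Data.Vec using ([]; _∷_; here; there)
open import Function using (_∘_; id; mk⇔; Equivalence; _⇔_)
open import Level using (0ℓ)
open import Relation.Binary using (Rel; _⇒_; tri<; tri≈; tri>)
open import Relation.Binary.PropositionalEquality
  using (_≡_; _≢_; refl; sym; trans; cong; cong₂; subst; module ≡-Reasoning)
open import Relation.Nullary using (¬_; Dec; yes; no)
open import Relation.Nullary.Decidable using (isYes; fromWitness; decidable-stable; ¬¬-excluded-middle)
open import Relation.Nullary.Negation using (¬¬-map)
open import Relation.Unary using (Pred; Decidable; U; ｛_｝; _∪_; _∩_; _∖_; _⊆_; _∈_; _∉_)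

open import Defs

open Equivalence using (to; from)
open Sum +-0-commutativeMonoid using (sum-syntax; ∑-comm; ∑-distrib-+; sum-replicate-zero; sum-cong-≗)

-- Paths inside a vertex set

VertexSet : ℕ → Set₁
VertexSet n = Pred (Fin n) 0ℓ

module _ {n : ℕ} where

  Arc : EdgeSet n → Rel (Fin n) 0ℓ
  Arc S u w = T (S u w)

  Link : EdgeSet n → Rel (Fin n) 0ℓ
  Link S u w = Arc S u w ⊎ Arc S w u

  Link-sym : ∀ {S u w} → Link S u w → Link S w u
  Link-sym (inj₁ e) = inj₂ e
  Link-sym (inj₂ e) = inj₁ e

  infixr 5 _∷⟨_⟩_

  data Path (R : Rel (Fin n) 0ℓ) (P : VertexSet n) : Rel (Fin n) 0ℓ where
    [_]    : ∀ {u} → u ∈ P → Path R P u u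
    _∷⟨_⟩_ : ∀ {u w x} → u ∈ P → R u w → Path R P w x → Path R P u x

  module _ {R : Rel (Fin n) 0ℓ} {P : VertexSet n} where

    vertices : ∀ {s t} → Path R P s t → List (Fin n)
    vertices ([_] {u} _)        = u ∷ []
    vertices (_∷⟨_⟩_ {u} _ _ p) = u ∷ vertices p

    infix 4 _∈ᵖ_ _∉ᵖ_

    _∈ᵖ_ : ∀ {s t} → Fin n → Path R P s t → Set
    z ∈ᵖ p = z ∈ₗ vertices p

    _∉ᵖ_ : ∀ {s t} → Fin n → Path R P s t → Set
    z ∉ᵖ p = ¬ z ∈ᵖ p

    Simple : ∀ {s t} → Path R P s t → Set
    Simple p = Unique (vertices p)

    source∈ᵖ : ∀ {s t} (p : Path R P s t) → s ∈ᵖ p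
    source∈ᵖ [ _ ]         = here refl
    source∈ᵖ (_ ∷⟨ _ ⟩ _) = here refl

    target∈ᵖ : ∀ {s t} (p : Path R P s t) → t ∈ᵖ p
    target∈ᵖ [ _ ]         = here refl
    target∈ᵖ (_ ∷⟨ _ ⟩ p) = there (target∈ᵖ p)

    ∈ᵖ⇒∈ : ∀ {s t z} (p : Path R P s t) → z ∈ᵖ p → z ∈ P
    ∈ᵖ⇒∈ [ pu ]         (here refl) = pu
    ∈ᵖ⇒∈ (pu ∷⟨ _ ⟩ _) (here refl) = pu
    ∈ᵖ⇒∈ (_ ∷⟨ _ ⟩ p)  (there m)   = ∈ᵖ⇒∈ p m

    source∈ : ∀ {s t} → Path R P s t → s ∈ P
    source∈ p = ∈ᵖ⇒∈ p (source∈ᵖ p)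

    target∈ : ∀ {s t} → Path R P s t → t ∈ P
    target∈ p = ∈ᵖ⇒∈ p (target∈ᵖ p)

    infixr 5 _++_

    _++_ : ∀ {a b c} → Path R P a b → Path R P b c → Path R P a c
    [ _ ]          ++ q = q
    (pu ∷⟨ e ⟩ p) ++ q = pu ∷⟨ e ⟩ (p ++ q)

    edge : ∀ {a b} → a ∈ P → b ∈ P → R a b → Path R P a b
    edge pa pb e = pa ∷⟨ e ⟩ [ pb ]

    suffix : ∀ {s t z} (p : Path R P s t) → z ∈ᵖ p → Path R P z t
    suffix [ pu ]          (here refl) = [ pu ]
    suffix (pu ∷⟨ e ⟩ p)  (here refl) = pu ∷⟨ e ⟩ p
    suffix (_ ∷⟨ _ ⟩ p)   (there m)   = suffix p m

    suffix-⊆ : ∀ {s t z y} (p : Path R P s t) (m : z ∈ᵖ p) → y ∈ᵖ suffix p m → y ∈ᵖ p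
    suffix-⊆ [ _ ]         (here refl) k = k
    suffix-⊆ (_ ∷⟨ _ ⟩ _) (here refl) k = k
    suffix-⊆ (_ ∷⟨ _ ⟩ p) (there m)   k = there (suffix-⊆ p m k)

    suffix-simple : ∀ {s t z} (p : Path R P s t) (m : z ∈ᵖ p) → Simple p → Simple (suffix p m)
    suffix-simple [ _ ]         (here refl) sp       = sp
    suffix-simple (_ ∷⟨ _ ⟩ _) (here refl) sp       = sp
    suffix-simple (_ ∷⟨ _ ⟩ p) (there m)   (_ ∷ sp) = suffix-simple p m sp

    prefix : ∀ {s t z} (p : Path R P s t) → z ∈ᵖ p → Path R P s z
    prefix [ pu ]          (here refl) = [ pu ]
    prefix (pu ∷⟨ _ ⟩ _)  (here refl) = [ pu ]
    prefix (pu ∷⟨ e ⟩ p)  (there m)   = pu ∷⟨ e ⟩ prefix p m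

    prefix-⊆ : ∀ {s t z y} (p : Path R P s t) (m : z ∈ᵖ p) → y ∈ᵖ prefix p m → y ∈ᵖ p
    prefix-⊆ [ _ ]          (here refl) k         = k
    prefix-⊆ (_ ∷⟨ _ ⟩ _)  (here refl) (here eq) = here eq
    prefix-⊆ (_ ∷⟨ _ ⟩ p)  (there m)   (here eq) = here eq
    prefix-⊆ (_ ∷⟨ _ ⟩ p)  (there m)   (there k) = there (prefix-⊆ p m k)

  restrict : ∀ {R R' : Rel (Fin n) 0ℓ} {P Q : VertexSet n} {s t} →
             R ⇒ R' → (p : Path R P s t) → (∀ {z} → z ∈ᵖ p → z ∈ Q) → Path R' Q s t
  restrict f [ _ ]          inQ = [ inQ (here refl) ]
  restrict f (_ ∷⟨ e ⟩ p)  inQ = inQ (here refl) ∷⟨ f e ⟩ restrict f p (inQ ∘ there)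

  mapᵖ : ∀ {R R' : Rel (Fin n) 0ℓ} {P Q : VertexSet n} {s t} →
         R ⇒ R' → P ⊆ Q → Path R P s t → Path R' Q s t
  mapᵖ f g p = restrict f p (g ∘ ∈ᵖ⇒∈ p)

  suffixIn : ∀ {R R' : Rel (Fin n) 0ℓ} {P Q : VertexSet n} {s t z} → R ⇒ R' →
             (p : Path R P s t) → z ∈ᵖ p → (∀ {y} → y ∈ᵖ p → y ∈ Q) → Path R' Q z t
  suffixIn f p m inQ = restrict f (suffix p m) (inQ ∘ suffix-⊆ p m)

  prefixIn : ∀ {R R' : Rel (Fin n) 0ℓ} {P Q : VertexSet n} {s t z} → R ⇒ R' →
             (p : Path R P s t) → z ∈ᵖ p → (∀ {y} → y ∈ᵖ p → y ∈ Q) → Path R' Q s z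
  prefixIn f p m inQ = restrict f (prefix p m) (inQ ∘ prefix-⊆ p m)

  reverseᵖ : ∀ {R R' : Rel (Fin n) 0ℓ} {P : VertexSet n} {s t} →
             (∀ {a b} → R a b → R' b a) → Path R P s t → Path R' P t s
  reverseᵖ f [ pu ]         = [ pu ]
  reverseᵖ f (pu ∷⟨ e ⟩ p) = reverseᵖ f p ++ edge (source∈ p) pu (f e)

  fromDPath : ∀ {S : EdgeSet n} {X a b} → DPath S X a b → Path (Arc S) U a b
  fromDPath (here _)     = [ tt ]
  fromDPath (step _ e p) = tt ∷⟨ e ⟩ fromDPath p

  onPath : ∀ {R P s t} → Path R P s t → VertexSet n
  onPath p z = z ∈ᵖ p

  module _ {R : Rel (Fin n) 0ℓ} {P : VertexSet n} where

    _∈ᵖ?_ : ∀ {s t} (z : Fin n) (p : Path R P s t) → Dec (z ∈ᵖ p)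
    z ∈ᵖ? p = any? (z ≟_) (vertices p)

    shortcut : ∀ {s t} → Path R P s t → Σ[ q ∈ Path R P s t ] Simple q
    shortcut [ pu ] = [ pu ] , [] ∷ []
    shortcut (_∷⟨_⟩_ {u} pu e p) with shortcut p
    ... | q , sq with u ∈ᵖ? q
    ...   | yes m = suffix q m , suffix-simple q m sq
    ...   | no u∉ = pu ∷⟨ e ⟩ q , ¬Any⇒All¬ (vertices q) u∉ ∷ sq

    LastVisit : ∀ {s t} → VertexSet n → Path R P s t → Set
    LastVisit A q = Σ[ c ∈ Fin n ] c ∈ A × Σ[ m ∈ c ∈ᵖ q ] (∀ {z} → z ∈ᵖ suffix q m → z ∈ A → z ≡ c)

    lastVisit : ∀ {A s t} → Decidable A → (q : Path R P s t) → (∀ {z} → z ∈ᵖ q → z ∉ A) ⊎ LastVisit A q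
    lastVisit A? ([_] {u} _) with A? u
    ... | yes uA = inj₂ (u , uA , here refl , λ { (here refl) _ → refl })
    ... | no uA  = inj₁ λ { (here refl) → uA }
    lastVisit A? (_∷⟨_⟩_ {u} _ _ q) with lastVisit A? q
    ... | inj₂ (c , cA , m , last) = inj₂ (c , cA , there m , last)
    ... | inj₁ none with A? u
    ...   | yes uA = inj₂ (u , uA , here refl , λ { (here refl) _ → refl ; (there k) zA → ⊥-elim (none k zA) })
    ...   | no uA  = inj₁ λ { (here refl) → uA ; (there k) → none k }

    lastStep : ∀ {s t} → s ≢ t → (p : Path R P s t) → Σ[ x ∈ Fin n ] x ≢ t × R x t × x ∈ᵖ p
    lastStep s≢t [ _ ] = ⊥-elim (s≢t refl)
    lastStep {t = t} s≢t (_∷⟨_⟩_ {w = w} _ e p) with w ≟ t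
    ... | yes refl = _ , s≢t , e , here refl
    ... | no w≢t = let (x , x≢t , e' , m) = lastStep w≢t p in x , x≢t , e' , there m

  ∉ᵖ⇒≢ : ∀ {R P s t x y} {p : Path R P s t} → x ∉ᵖ p → y ∈ᵖ p → x ≢ y
  ∉ᵖ⇒≢ x∉p y∈p refl = x∉p y∈p

  record Fork (R : Rel (Fin n) 0ℓ) (a b : Fin n) : Set where
    field
      apex         : Fin n
      left         : Path R U apex a
      right        : Path R U apex b
      left-simple  : Simple left
      right-simple : Simple right
      disjoint     : ∀ {z} → z ∈ᵖ left → z ∈ᵖ right → z ≡ apex

  fork : ∀ {R s a b} (pa : Path R U s a) (pb : Path R U s b) → Simple pa → Simple pb → Fork R a b
  fork pa pb spa spb with lastVisit (_∈ᵖ? pa) pb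
  ... | inj₁ none = ⊥-elim (none (source∈ᵖ pb) (source∈ᵖ pa))
  ... | inj₂ (c , c∈pa , c∈pb , last) = record
    { apex         = c
    ; left         = suffix pa c∈pa
    ; right        = suffix pb c∈pb
    ; left-simple  = suffix-simple pa c∈pa spa
    ; right-simple = suffix-simple pb c∈pb spb
    ; disjoint     = λ z∈l z∈r → last z∈r (suffix-⊆ pa c∈pa z∈l)
    }

  -- Strongly biconnected vertex sets

  PathConnected : Rel (Fin n) 0ℓ → VertexSet n → Set
  PathConnected R P = ∀ a b → a ∈ P → b ∈ P → Path R P a b

  StronglyConnected : EdgeSet n → VertexSet n → Set
  StronglyConnected S = PathConnected (Arc S)

  WeaklyConnected : EdgeSet n → VertexSet n → Set
  WeaklyConnected S = PathConnected (Link S)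

  -- For x ∉ P this says that P itself is connected.
  CutFree : EdgeSet n → VertexSet n → Set
  CutFree S P = ∀ x → WeaklyConnected S (P ∖ ｛ x ｝)

  StronglyBiconnectedSet : EdgeSet n → VertexSet n → Set
  StronglyBiconnectedSet S P = StronglyConnected S P × CutFree S P

  infix 4 _⊆ᴱ_

  _⊆ᴱ_ : EdgeSet n → EdgeSet n → Set
  S ⊆ᴱ S' = Arc S ⇒ Arc S'

  Link-mono : ∀ {S S'} → S ⊆ᴱ S' → ∀ {a b} → Link S a b → Link S' a b
  Link-mono h (inj₁ e) = inj₁ (h e)
  Link-mono h (inj₂ e) = inj₂ (h e)

  StronglyBiconnectedSet-mono : ∀ {S S' P} → S ⊆ᴱ S' → StronglyBiconnectedSet S P → StronglyBiconnectedSet S' P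
  StronglyBiconnectedSet-mono {S} {S'} h (sc , cf) =
    (λ a b pa pb → mapᵖ h id (sc a b pa pb)) ,
    (λ x a b pa pb → mapᵖ (Link-mono {S} {S'} h) id (cf x a b pa pb))

  PathConnected-hub : ∀ {R P} h → (∀ z → z ∈ P → Path R P h z × Path R P z h) → PathConnected R P
  PathConnected-hub h paths a b pa pb = proj₂ (paths a pa) ++ proj₁ (paths b pb)

  PathConnected-∪ : ∀ {R P Q c} → PathConnected R P → PathConnected R Q → c ∈ P → c ∈ Q →
                    PathConnected R (P ∪ Q)
  PathConnected-∪ {c = c} conP conQ cP cQ = PathConnected-hub c λ where
    z (inj₁ zP) → mapᵖ id inj₁ (conP c z cP zP) , mapᵖ id inj₁ (conP z c zP cP)
    z (inj₂ zQ) → mapᵖ id inj₂ (conQ c z cQ zQ) , mapᵖ id inj₂ (conQ z c zQ cQ)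

  ShareTwo : VertexSet n → VertexSet n → Set
  ShareTwo P Q = Σ[ c₁ ∈ Fin n ] Σ[ c₂ ∈ Fin n ] c₁ ≢ c₂ × c₁ ∈ P ∩ Q × c₂ ∈ P ∩ Q

  ShareTwo-sym : ∀ {P Q} → ShareTwo P Q → ShareTwo Q P
  ShareTwo-sym (c₁ , c₂ , c₁≢c₂ , (c₁P , c₁Q) , (c₂P , c₂Q)) =
    c₁ , c₂ , c₁≢c₂ , (c₁Q , c₁P) , (c₂Q , c₂P)

  ShareTwo-mono : ∀ {P P' Q Q'} → P ⊆ P' → Q ⊆ Q' → ShareTwo P Q → ShareTwo P' Q'
  ShareTwo-mono f g (c₁ , c₂ , c₁≢c₂ , (c₁P , c₁Q) , (c₂P , c₂Q)) =
    c₁ , c₂ , c₁≢c₂ , (f c₁P , g c₁Q) , (f c₂P , g c₂Q)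

  CutFree-∪ : ∀ {S P Q} → CutFree S P → CutFree S Q → ShareTwo P Q → CutFree S (P ∪ Q)
  CutFree-∪ {S} {P} {Q} cfP cfQ (c₁ , c₂ , c₁≢c₂ , (c₁P , c₁Q) , (c₂P , c₂Q)) x a b pa pb = pick (x ≟ c₁)
    where
    avoid : (P ∖ ｛ x ｝) ∪ (Q ∖ ｛ x ｝) ⊆ (P ∪ Q) ∖ ｛ x ｝
    avoid (inj₁ (zP , x≢z)) = inj₁ zP , x≢z
    avoid (inj₂ (zQ , x≢z)) = inj₂ zQ , x≢z
    split : (P ∪ Q) ∖ ｛ x ｝ ⊆ (P ∖ ｛ x ｝) ∪ (Q ∖ ｛ x ｝)
    split (inj₁ zP , x≢z) = inj₁ (zP , x≢z)
    split (inj₂ zQ , x≢z) = inj₂ (zQ , x≢z)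
    via : ∀ {c} → c ∈ P → c ∈ Q → x ≢ c → Path (Link S) ((P ∪ Q) ∖ ｛ x ｝) a b
    via cP cQ x≢c = mapᵖ id avoid (PathConnected-∪ (cfP x) (cfQ x) (cP , x≢c) (cQ , x≢c) a b (split pa) (split pb))
    pick : Dec (x ≡ c₁) → Path (Link S) ((P ∪ Q) ∖ ｛ x ｝) a b
    pick (yes refl) = via c₂P c₂Q c₁≢c₂
    pick (no x≢c₁)  = via c₁P c₁Q x≢c₁

  StronglyBiconnectedSet-singleton : ∀ {S} u → StronglyBiconnectedSet S ｛ u ｝
  StronglyBiconnectedSet-singleton u =
    (λ { _ _ refl refl → [ refl ] }) , λ { x _ _ (refl , x≢u) (refl , _) → [ refl , x≢u ] }

  StronglyBiconnectedSet-∪ : ∀ {S P Q} → StronglyBiconnectedSet S P → StronglyBiconnectedSet S Q →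
                             ShareTwo P Q → StronglyBiconnectedSet S (P ∪ Q)
  StronglyBiconnectedSet-∪ (scP , cfP) (scQ , cfQ) share@(_ , _ , _ , (c₁P , c₁Q) , _) =
    PathConnected-∪ scP scQ c₁P c₁Q , CutFree-∪ cfP cfQ share

  module _ {R : Rel (Fin n) 0ℓ} {S : EdgeSet n} (toLink : R ⇒ Link S) where

    escape : ∀ {s t x y} (p : Path R U s t) → Simple p → y ∈ᵖ p → x ≢ y →
             Path (Link S) (onPath p ∖ ｛ x ｝) y s ⊎ Path (Link S) (onPath p ∖ ｛ x ｝) y t
    escape [ _ ]          _          (here refl) x≢y = inj₁ [ here refl , x≢y ]
    escape (_ ∷⟨ _ ⟩ _)  _          (here refl) x≢y = inj₁ [ here refl , x≢y ]
    escape {s} {x = x} (_ ∷⟨ e ⟩ p) (s∉p ∷ sp) (there m) x≢y with escape p sp m x≢y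
    ... | inj₂ q = inj₂ (mapᵖ id later q)
      where later : ∀ {z} → z ∈ onPath p ∖ ｛ x ｝ → z ∈ onPath (_ ∷⟨ e ⟩ p) ∖ ｛ x ｝
            later (k , x≢z) = there k , x≢z
    ... | inj₁ q with x ≟ s
    ...   | yes refl = inj₂ (suffixIn toLink p m λ k → there k , lookup s∉p k)
    ...   | no x≢s = inj₁ (mapᵖ id later q ++ edge (target∈ (mapᵖ id later q)) (here refl , x≢s)
                                                     (Link-sym {S} (toLink e)))
      where later : ∀ {z} → z ∈ onPath p ∖ ｛ x ｝ → z ∈ onPath (_ ∷⟨ e ⟩ p) ∖ ｛ x ｝
            later (k , x≢z) = there k , x≢z

    -- A vertex of a branch reaches P avoiding x along its own branch, or through the apex
    -- along the other branch, which cannot contain x.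
    CutFree-ear : ∀ {P c a b} → CutFree S P → (A : Path R U c a) (B : Path R U c b) → Simple A → Simple B →
                  a ∈ P → b ∈ P → (∀ {z} → z ∈ᵖ A → z ∈ᵖ B → z ≡ c) →
                  CutFree S (P ∪ (onPath A ∪ onPath B))
    CutFree-ear {P} {c} cfP A B sA sB aP bP A∩B x u w (u∈ , x≢u) (w∈ , x≢w) =
      let (p , p∈ , u→p) = exit u u∈ x≢u
          (q , q∈ , w→q) = exit w w∈ x≢w
      in u→p ++ mapᵖ id (λ (zP , x≢z) → inj₁ zP , x≢z) (cfP x p q p∈ q∈) ++ reverseᵖ (Link-sym {S}) w→q
      where
      P' = P ∪ (onPath A ∪ onPath B)

      Exit : Fin n → Set
      Exit z = Σ[ p ∈ Fin n ] p ∈ P ∖ ｛ x ｝ × Path (Link S) (P' ∖ ｛ x ｝) z p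

      along : ∀ {a' b' z} (A' : Path R U c a') (B' : Path R U c b') → Simple A' → a' ∈ P → b' ∈ P →
              (∀ {z} → z ∈ᵖ A' → z ∈ᵖ B' → z ≡ c) → onPath A' ⊆ P' → onPath B' ⊆ P' →
              z ∈ᵖ A' → x ≢ z → Exit z
      along {a'} {b'} A' B' sA' a'P b'P A'∩B' inA inB z∈ x≢z with x ∈ᵖ? A'
      ... | no x∉A' = a' , (a'P , ∉ᵖ⇒≢ x∉A' (target∈ᵖ A')) ,
                      suffixIn toLink A' z∈ (λ k → inA k , ∉ᵖ⇒≢ x∉A' k)
      ... | yes x∈A' with escape A' sA' z∈ x≢z
      ...   | inj₂ z→a' = a' , (a'P , proj₂ (target∈ z→a')) , mapᵖ id (λ (k , x≢y) → inA k , x≢y) z→a'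
      ...   | inj₁ z→c = b' , (b'P , ∉ᵖ⇒≢ x∉B' (target∈ᵖ B')) ,
                         mapᵖ id (λ (k , x≢y) → inA k , x≢y) z→c ++
                         suffixIn toLink B' (source∈ᵖ B') (λ k → inB k , ∉ᵖ⇒≢ x∉B' k)
        where
        x∉B' : x ∉ᵖ B'
        x∉B' x∈B' = proj₂ (target∈ z→c) (A'∩B' x∈A' x∈B')

      exit : ∀ z → z ∈ P' → x ≢ z → Exit z
      exit z (inj₁ zP)        x≢z = z , (zP , x≢z) , [ inj₁ zP , x≢z ]
      exit z (inj₂ (inj₁ zA)) x≢z = along A B sA aP bP A∩B (inj₂ ∘ inj₁) (inj₂ ∘ inj₂) zA x≢z
      exit z (inj₂ (inj₂ zB)) x≢z =
        along B A sB bP aP (λ zB zA → A∩B zA zB) (inj₂ ∘ inj₂) (inj₂ ∘ inj₁) zB x≢z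

  CutFree-arc : ∀ {S a b} → Arc S a b → CutFree S (｛ a ｝ ∪ ｛ b ｝)
  CutFree-arc e x _ _ (inj₁ refl , x≢u) (inj₁ refl , _)   = [ inj₁ refl , x≢u ]
  CutFree-arc e x _ _ (inj₂ refl , x≢u) (inj₂ refl , _)   = [ inj₂ refl , x≢u ]
  CutFree-arc e x _ _ (inj₁ refl , x≢u) (inj₂ refl , x≢w) = edge (inj₁ refl , x≢u) (inj₂ refl , x≢w) (inj₁ e)
  CutFree-arc e x _ _ (inj₂ refl , x≢u) (inj₁ refl , x≢w) = edge (inj₂ refl , x≢u) (inj₁ refl , x≢w) (inj₂ e)

  StronglyBiconnectedSet-cycle : ∀ {R S u w} → R ⇒ Arc S → Arc S u w →
                                 (p : Path R U w u) → Simple p → StronglyBiconnectedSet S (onPath p)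
  StronglyBiconnectedSet-cycle {R} {S} {u} {w} toArc uw p sp = PathConnected-hub w hub , cutFree
    where
    hub : ∀ z → z ∈ᵖ p → Path (Arc S) (onPath p) w z × Path (Arc S) (onPath p) z w
    hub z m = prefixIn toArc p m id , suffixIn toArc p m id ++ edge (target∈ᵖ p) (source∈ᵖ p) uw

    Ear : VertexSet n
    Ear = (｛ u ｝ ∪ ｛ w ｝) ∪ (onPath ([_] {R = R} {U} {w} tt) ∪ onPath p)

    ear : CutFree S Ear
    ear = CutFree-ear {R = R} {S} (inj₁ ∘ toArc) (CutFree-arc uw) [ tt ] p ([] ∷ []) sp (inj₂ refl) (inj₁ refl)
                      (λ { (here refl) _ → refl })

    shrink : ∀ {x} → Ear ∖ ｛ x ｝ ⊆ onPath p ∖ ｛ x ｝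
    shrink (inj₁ (inj₁ refl) , x≢z)         = target∈ᵖ p , x≢z
    shrink (inj₁ (inj₂ refl) , x≢z)         = source∈ᵖ p , x≢z
    shrink (inj₂ (inj₁ (here refl)) , x≢z) = source∈ᵖ p , x≢z
    shrink (inj₂ (inj₂ m) , x≢z)            = m , x≢z

    cutFree : CutFree S (onPath p)
    cutFree x a b (ma , x≢a) (mb , x≢b) =
      mapᵖ id shrink (ear x a b (inj₂ (inj₂ ma) , x≢a) (inj₂ (inj₂ mb) , x≢b))


  -- The redundant onPath [ b ] comes from attaching q as an ear whose other branch is trivial.
  forkCycle : ∀ {R S a b} (F : Fork R a b) → Path (Arc S) U b (Fork.apex F) → VertexSet n
  forkCycle {S = S} {a} {b} F q =
    ((｛ a ｝ ∪ ｛ b ｝) ∪ (onPath (Fork.left F) ∪ onPath (Fork.right F))) ∪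
    (onPath ([_] {R = Arc S} {U} {b} tt) ∪ onPath q)

  StronglyBiconnectedSet-forkCycle : ∀ {R S a b} → R ⇒ Arc S → Arc S a b → (F : Fork R a b) →
                                     (q : Path (Arc S) U b (Fork.apex F)) → Simple q →
                                     StronglyBiconnectedSet S (forkCycle F q)
  StronglyBiconnectedSet-forkCycle {S = S} {a} {b} toArc ab F q sq = PathConnected-hub c hub , cutFree
    where
    open Fork F renaming (apex to c)
    P = forkCycle F q

    a∈ : a ∈ P
    a∈ = inj₁ (inj₁ (inj₁ refl))
    b∈ : b ∈ P
    b∈ = inj₁ (inj₁ (inj₂ refl))
    inLeft : ∀ {z} → z ∈ᵖ left → z ∈ P
    inLeft = inj₁ ∘ inj₂ ∘ inj₁
    inRight : ∀ {z} → z ∈ᵖ right → z ∈ P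
    inRight = inj₁ ∘ inj₂ ∘ inj₂
    inQ : ∀ {z} → z ∈ᵖ q → z ∈ P
    inQ = inj₂ ∘ inj₂

    cutFree : CutFree S P
    cutFree = CutFree-ear {R = Arc S} inj₁
                (CutFree-ear (inj₁ ∘ toArc) (CutFree-arc ab) left right left-simple right-simple
                             (inj₁ refl) (inj₂ refl) disjoint)
                [ tt ] q ([] ∷ []) sq (inj₁ (inj₂ refl)) (inj₂ (inj₁ (source∈ᵖ left)))
                λ { (here refl) _ → refl }

    c→a : Path (Arc S) P c a
    c→a = restrict toArc left inLeft
    b→c : Path (Arc S) P b c
    b→c = restrict id q inQ
    c→b : Path (Arc S) P c b
    c→b = c→a ++ edge a∈ b∈ ab

    hub : ∀ z → z ∈ P → Path (Arc S) P c z × Path (Arc S) P z c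
    hub z (inj₁ (inj₁ (inj₁ refl))) = c→a , a∈ ∷⟨ ab ⟩ b→c
    hub z (inj₁ (inj₁ (inj₂ refl))) = c→b , b→c
    hub z (inj₁ (inj₂ (inj₁ m)))    = prefixIn toArc left m inLeft ,
                                       suffixIn toArc left m inLeft ++ a∈ ∷⟨ ab ⟩ b→c
    hub z (inj₁ (inj₂ (inj₂ m)))    = prefixIn toArc right m inRight ,
                                       suffixIn toArc right m inRight ++ b→c
    hub z (inj₂ (inj₁ (here refl))) = c→b , b→c
    hub z (inj₂ (inj₂ m))           = c→b ++ prefixIn id q m inQ , suffixIn id q m inQ

-- Classes of tree arcs

module TreeArcs {n : ℕ} {E : EdgeSet n} {v : Fin n} {Tr : EdgeSet n} (tree : SpanningTree E v Tr) where
  open SpanningTree tree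

  parent : Fin n → Fin n
  parent y with y ≟ v
  ... | yes _   = v
  ... | no y≢v = proj₁ (uniqueIn y y≢v)

  parent-arc : ∀ {y} → y ≢ v → Arc Tr (parent y) y
  parent-arc {y} y≢v with y ≟ v
  ... | yes y≡v  = ⊥-elim (y≢v y≡v)
  ... | no y≢v′ = proj₁ (proj₂ (uniqueIn y y≢v′))

  arc-target≢root : ∀ {x y} → Arc Tr x y → y ≢ v
  arc-target≢root {x} e refl = rootNoIn x e

  parent-unique : ∀ {x y} → Arc Tr x y → x ≡ parent y
  parent-unique {x} {y} e with y ≟ v
  ... | yes y≡v = ⊥-elim (arc-target≢root e y≡v)
  ... | no y≢v  = proj₂ (proj₂ (uniqueIn y y≢v)) x e

  parent≢ : ∀ {y} → y ≢ v → parent y ≢ y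
  parent≢ {y} y≢v parent≡y with lastStep (y≢v ∘ sym) (fromDPath (spanning y))
  ... | x , x≢y , e , _ = x≢y (trans (parent-unique e) parent≡y)

  treeFork : ∀ a b → Fork (Arc Tr) a b
  treeFork a b = let (pa , spa) = shortcut (fromDPath (spanning a))
                     (pb , spb) = shortcut (fromDPath (spanning b))
                 in fork pa pb spa spb

  record Block (S : EdgeSet n) (y : Fin n) : Set₁ where
    field
      members : VertexSet n
      strong  : StronglyBiconnectedSet S members
      nonRoot : y ≢ v
      head∈   : y ∈ members
      tail∈   : parent y ∈ members

  open Block public

  InBlockOf : EdgeSet n → Fin n → Fin n → Fin n → Set₁
  InBlockOf S y a b = Σ[ B ∈ Block S y ] a ∈ members B × b ∈ members B

  Block-share : ∀ {S y Q} (B : Block S y) → y ∈ Q → parent y ∈ Q → ShareTwo Q (members B)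
  Block-share B y∈Q py∈Q = _ , _ , parent≢ (nonRoot B) ∘ sym , (y∈Q , head∈ B) , (py∈Q , tail∈ B)

  Block-∪ : ∀ {S y Q} (B : Block S y) → StronglyBiconnectedSet S Q → ShareTwo (members B) Q → Block S y
  Block-∪ {Q = Q} B sbQ share = record
    { members = members B ∪ Q
    ; strong  = StronglyBiconnectedSet-∪ (strong B) sbQ share
    ; nonRoot = nonRoot B
    ; head∈   = inj₁ (head∈ B)
    ; tail∈   = inj₁ (tail∈ B)
    }

  Block-mono : ∀ {S S' y} → S ⊆ᴱ S' → Block S y → Block S' y
  Block-mono S⊆S' B = record
    { members = members B
    ; strong  = StronglyBiconnectedSet-mono S⊆S' (strong B)
    ; nonRoot = nonRoot B
    ; head∈   = head∈ B
    ; tail∈   = tail∈ B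
    }

  reroot : ∀ {S y y'} (B : Block S y) → y' ≢ v → y' ∈ members B → parent y' ∈ members B → Block S y'
  reroot B y'≢v y'∈ py'∈ = record
    { members = members B ; strong = strong B ; nonRoot = y'≢v ; head∈ = y'∈ ; tail∈ = py'∈ }

  Same : EdgeSet n → Fin n → Fin n → Set₁
  Same S y₁ y₂ = (y₁ ≡ v × y₂ ≡ v) ⊎ (y₂ ≢ v × InBlockOf S y₁ y₂ (parent y₂))

  Same-sym : ∀ {S y₁ y₂} → Same S y₁ y₂ → Same S y₂ y₁
  Same-sym (inj₁ (y₁≡v , y₂≡v))            = inj₁ (y₂≡v , y₁≡v)
  Same-sym (inj₂ (y₂≢v , B , y₂∈ , py₂∈)) =
    inj₂ (nonRoot B , reroot B y₂≢v y₂∈ py₂∈ , head∈ B , tail∈ B)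

  Same-trans : ∀ {S y₁ y₂ y₃} → Same S y₁ y₂ → Same S y₂ y₃ → Same S y₁ y₃
  Same-trans (inj₁ (y₁≡v , _))    (inj₁ (_ , y₃≡v))    = inj₁ (y₁≡v , y₃≡v)
  Same-trans (inj₁ (_ , y₂≡v))    (inj₂ (_ , B , _))   = ⊥-elim (nonRoot B y₂≡v)
  Same-trans (inj₂ (y₂≢v , _))    (inj₁ (y₂≡v , _))    = ⊥-elim (y₂≢v y₂≡v)
  Same-trans (inj₂ (_ , B₁₂ , y₂∈ , py₂∈)) (inj₂ (y₃≢v , B₂₃ , y₃∈ , py₃∈)) =
    inj₂ (y₃≢v , Block-∪ B₁₂ (strong B₂₃) (Block-share B₂₃ y₂∈ py₂∈) , inj₂ y₃∈ , inj₂ py₃∈)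

  Same-mono : ∀ {S S'} → S ⊆ᴱ S' → ∀ {y₁ y₂} → Same S y₁ y₂ → Same S' y₁ y₂
  Same-mono S⊆S' (inj₁ roots)                = inj₁ roots
  Same-mono S⊆S' (inj₂ (y₂≢v , B , y₂∈ , py₂∈)) = inj₂ (y₂≢v , Block-mono S⊆S' B , y₂∈ , py₂∈)

  module Spanned {S : EdgeSet n} (Tr⊆S : Tr ⊆ᴱ S) (reach : ∀ a b → Path (Arc S) U a b) where

    treeArcBlock : ∀ {y} → y ≢ v → Block S y
    treeArcBlock {y} y≢v = record
      { members = onPath cycle
      ; strong  = StronglyBiconnectedSet-cycle id (Tr⊆S (parent-arc y≢v)) cycle simple
      ; nonRoot = y≢v
      ; head∈   = source∈ᵖ cycle
      ; tail∈   = target∈ᵖ cycle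
      }
      where
      cycle = proj₁ (shortcut (reach y (parent y)))
      simple = proj₂ (shortcut (reach y (parent y)))

    Same-refl : ∀ y → Same S y y
    Same-refl y = byRoot (y ≟ v)
      where
      byRoot : Dec (y ≡ v) → Same S y y
      byRoot (yes y≡v) = inj₁ (y≡v , y≡v)
      byRoot (no y≢v)  = inj₂ (y≢v , treeArcBlock y≢v , head∈ (treeArcBlock y≢v) , tail∈ (treeArcBlock y≢v))

    arcBlock : ∀ {a b} → a ≢ b → Arc S a b → ∃[ y ] InBlockOf S y a b
    arcBlock {a} {b} a≢b ab = byApex (c ≟ b)
      where
      F = treeFork a b
      open Fork F renaming (apex to c)
      back = shortcut (reach b c)
      P = forkCycle F (proj₁ back)

      lastTreeArc : ∀ {t} → c ≢ t → (p : Path (Arc Tr) U c t) → (∀ {z} → z ∈ᵖ p → z ∈ P) →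
                    t ≢ v × parent t ∈ P
      lastTreeArc c≢t p inP with lastStep c≢t p
      ... | _ , _ , e , m = arc-target≢root e , subst (_∈ P) (parent-unique e) (inP m)

      blockAt : ∀ {y} → y ∈ P → y ≢ v × parent y ∈ P → Block S y
      blockAt y∈ (y≢v , py∈) = record
        { members = P
        ; strong  = StronglyBiconnectedSet-forkCycle Tr⊆S ab F (proj₁ back) (proj₂ back)
        ; nonRoot = y≢v
        ; head∈   = y∈
        ; tail∈   = py∈
        }

      a∈ : a ∈ P
      a∈ = inj₁ (inj₁ (inj₁ refl))
      b∈ : b ∈ P
      b∈ = inj₁ (inj₁ (inj₂ refl))

      byApex : Dec (c ≡ b) → ∃[ y ] InBlockOf S y a b
      byApex (no c≢b)  = b , blockAt b∈ (lastTreeArc c≢b right (inj₁ ∘ inj₂ ∘ inj₂)) , a∈ , b∈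
      byApex (yes c≡b) = a , blockAt a∈ (lastTreeArc c≢a left (inj₁ ∘ inj₂ ∘ inj₁)) , a∈ , b∈
        where c≢a = λ c≡a → a≢b (trans (sym c≡a) c≡b)

  glue : ∀ {S y y' a b c d} → InBlockOf S y a b → Same S y y' → InBlockOf S y' c d → InBlockOf S y a d
  glue (B , _) (inj₁ (y≡v , _)) _ = ⊥-elim (nonRoot B y≡v)
  glue (B , a∈ , _) (inj₂ (_ , H , y'∈ , py'∈)) (B' , _ , d∈) =
    Block-∪ (Block-∪ B (strong H) (Block-share H (head∈ B) (tail∈ B)))
            (strong B') (Block-share B' (inj₂ y'∈) (inj₂ py'∈)) ,
    inj₁ (inj₁ a∈) , inj₂ d∈

-- Classical reasoning and strongly biconnected components

infixl 1 _>>=_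

_>>=_ : ∀ {a b} {A : Set a} {B : Set b} → ¬ ¬ A → (A → ¬ ¬ B) → ¬ ¬ B
m >>= f = λ k → m (λ x → f x k)

pure : ∀ {a} {A : Set a} → A → ¬ ¬ A
pure x k = k x

Represents : ∀ {n ℓ} → Subset n → Pred (Fin n) ℓ → Set ℓ
Represents X P = ∀ z → z ∈ₛ X ⇔ z ∈ P

realize : ∀ {n ℓ} (P : Pred (Fin n) ℓ) → ¬ ¬ (Σ[ X ∈ Subset n ] Represents X P)
realize {zero}  P = pure ([] , λ ())
realize {suc n} P = do
    (X , rep) ← realize (P ∘ fsuc)
    p0? ← ¬¬-excluded-middle
    pure (extend p0? X rep)
  where
  extend : Dec (P fzero) → (X : Subset n) → Represents X (P ∘ fsuc) → Σ[ X' ∈ Subset (suc n) ] Represents X' P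
  extend (yes p0) X rep = inside ∷ X , λ where
    fzero    → mk⇔ (λ _ → p0) (λ _ → here)
    (fsuc z) → mk⇔ (λ { (there m) → to (rep z) m }) (there ∘ from (rep z))
  extend (no ¬p0) X rep = outside ∷ X , λ where
    fzero    → mk⇔ (λ ()) (⊥-elim ∘ ¬p0)
    (fsuc z) → mk⇔ (λ { (there m) → to (rep z) m }) (there ∘ from (rep z))

x∈p-y⇒x≢y : ∀ {n} {p : Subset n} {x y} → x ∈ₛ p - y → x ≢ y
x∈p-y⇒x≢y {p = p} {y = y} m refl = ∉─ p ⁅ y ⁆ m (x∈⁅x⁆ y)
  where
  ∉─ : ∀ {n} (p q : Subset n) {x} → x ∈ₛ p ─ q → x ∉ₛ q
  ∉─ (_ ∷ _) (inside ∷ _) ()        here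
  ∉─ (_ ∷ p) (_ ∷ q)      (there m) (there m') = ∉─ p q m m'

module _ {n : ℕ} (S : EdgeSet n) where

  toDPath : ∀ {P X a b} → (∀ {z} → z ∈ P → z ∈ₛ X) → Path (Arc S) P a b → DPath S X a b
  toDPath inX [ pa ]         = here (inX pa)
  toDPath inX (pa ∷⟨ e ⟩ p) = step (inX pa) e (toDPath inX p)

  toUPath : ∀ {P X a b} → (∀ {z} → z ∈ P → z ∈ₛ X) → Path (Link S) P a b → UPath S X a b
  toUPath inX [ pa ]         = here (inX pa)
  toUPath inX (pa ∷⟨ e ⟩ p) = step (inX pa) e (toUPath inX p)

  StronglyBiconnectedSet⇒On : ∀ {X P} → Represents X P → StronglyBiconnectedSet S P → StronglyBiconnectedOn S X
  StronglyBiconnectedSet⇒On {X} {P} rep (sc , cf) = strong , noCut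
    where
    strong : StronglyConnectedOn S X
    strong a b a∈ b∈ = toDPath (from (rep _)) (sc a b (to (rep a) a∈) (to (rep b) b∈))
    noCut : ∀ x → ¬ ArticulationPoint S X x
    noCut x (_ , y , z , y∈ , z∈ , _ , ¬path) = ¬path (toUPath inner (cf x y z (outer y∈) (outer z∈)))
      where
      outer : ∀ {w} → w ∈ₛ X - x → w ∈ P ∖ ｛ x ｝
      outer m = to (rep _) (p─q⊆p X ⁅ x ⁆ m) , x∈p-y⇒x≢y m ∘ sym
      inner : ∀ {w} → w ∈ P ∖ ｛ x ｝ → w ∈ₛ X - x
      inner (w∈ , x≢w) = x∈p∧x≢y⇒x∈p-y (from (rep _) w∈) (x≢w ∘ sym)

  extendToComponent : ∀ k (X : Subset n) → n ∸ ∣ X ∣ ≤ k → StronglyBiconnectedOn S X →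
                      ¬ ¬ (Σ[ Y ∈ Subset n ] SBComponent S Y × X ⊆ₛ Y)
  extendToComponent k X bound sbX = do
      larger? ← ¬¬-excluded-middle
      grow larger?
    where
    grow : Dec (Σ[ Y ∈ Subset n ] X ⊂ₛ Y × StronglyBiconnectedOn S Y) →
           ¬ ¬ (Σ[ Y ∈ Subset n ] SBComponent S Y × X ⊆ₛ Y)
    grow (no maximal) = pure (X , (sbX , closed) , λ {_} m → m)
      where
      closed : ∀ Y → X ⊆ₛ Y → StronglyBiconnectedOn S Y → Y ⊆ₛ X
      closed Y X⊆Y sbY {x} x∈Y =
        decidable-stable (x ∈? X) (λ x∉X → maximal (Y , ((λ {z} → X⊆Y {z}) , x , x∈Y , x∉X) , sbY))
    grow (yes (Y , X⊂Y , sbY)) = descend k bound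
      where
      shrinks : n ∸ ∣ Y ∣ < n ∸ ∣ X ∣
      shrinks = ∸-monoʳ-< (p⊂q⇒∣p∣<∣q∣ X⊂Y) (∣p∣≤n Y)
      descend : ∀ k → n ∸ ∣ X ∣ ≤ k → ¬ ¬ (Σ[ Z ∈ Subset n ] SBComponent S Z × X ⊆ₛ Z)
      descend zero    X≤0 = ⊥-elim (<⇒≱ shrinks (≤-trans X≤0 z≤n))
      descend (suc k) X≤k = do
        (Z , component , Y⊆Z) ← extendToComponent k Y (≤-pred (≤-trans shrinks X≤k)) sbY
        pure (Z , component , λ {_} → Y⊆Z ∘ proj₁ X⊂Y)

  Together : Fin n → Fin n → Set₁
  Together u w = Σ[ P ∈ VertexSet n ] StronglyBiconnectedSet S P × u ∈ P × w ∈ P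

  together⇒sameComponent : ∀ {u w} → Together u w → ¬ ¬ SameSBComponent S u w
  together⇒sameComponent (P , sbP , u∈ , w∈) = do
    (X , rep) ← realize P
    (Y , component , X⊆Y) ← extendToComponent n X (m∸n≤m n ∣ X ∣) (StronglyBiconnectedSet⇒On rep sbP)
    pure (Y , component , X⊆Y (from (rep _) u∈) , X⊆Y (from (rep _) w∈))

-- Counting arcs

𝟙 : Bool → ℕ
𝟙 b = if b then 1 else 0

𝟙-∨ : ∀ b c → 𝟙 (b ∨ c) ≤ 𝟙 b + 𝟙 c
𝟙-∨ true  c = s≤s z≤n
𝟙-∨ false c = ≤-refl

sum-allFin : ∀ {n} (f : Fin n → ℕ) → List.sum (map f (allFin n)) ≡ ∑[ i < n ] f i
sum-allFin {zero}  f = refl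
sum-allFin {suc n} f = cong (f fzero +_) (begin
    List.sum (map f (tabulate fsuc))          ≡⟨ cong List.sum (map-tabulate fsuc f) ⟩
    List.sum (tabulate (f ∘ fsuc))            ≡⟨ cong List.sum (map-tabulate id (f ∘ fsuc)) ⟨
    List.sum (map (f ∘ fsuc) (allFin n))      ≡⟨ sum-allFin (f ∘ fsuc) ⟩
    ∑[ i < n ] f (fsuc i)                     ∎)
  where open ≡-Reasoning

∑-mono-≤ : ∀ {n} {f g : Fin n → ℕ} → (∀ i → f i ≤ g i) → ∑[ i < n ] f i ≤ ∑[ i < n ] g i
∑-mono-≤ {zero}  f≤g = z≤n
∑-mono-≤ {suc n} f≤g = +-mono-≤ (f≤g fzero) (∑-mono-≤ (f≤g ∘ fsuc))

∑-const-1 : ∀ n → ∑[ i < n ] 1 ≡ n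
∑-const-1 zero    = refl
∑-const-1 (suc n) = cong suc (∑-const-1 n)

∑-indicator : ∀ {n} (c : Fin n) → ∑[ i < n ] 𝟙 (isYes (i ≟ c)) ≡ 1
∑-indicator {suc n} fzero    = cong suc (sum-replicate-zero n)
∑-indicator {suc n} (fsuc c) = trans (sum-cong-≗ (λ i → cong 𝟙 (isYes-suc i))) (∑-indicator c)
  where
  isYes-suc : ∀ i → isYes (fsuc i ≟ fsuc c) ≡ isYes (i ≟ c)
  isYes-suc i with i ≟ c
  ... | yes _ = refl
  ... | no _  = refl

𝟙-mono : ∀ {b c} → (T b → T c) → 𝟙 b ≤ 𝟙 c
𝟙-mono {false}         _   = z≤n
𝟙-mono {true} {true}   _   = ≤-refl
𝟙-mono {true} {false} b⇒c = ⊥-elim (b⇒c tt)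

module _ {n : ℕ} where

  edgeCount-∑ : (S : EdgeSet n) → edgeCount S ≡ ∑[ u < n ] ∑[ w < n ] 𝟙 (S u w)
  edgeCount-∑ S = trans (cong List.sum (map-cong (λ u → sum-allFin (λ w → 𝟙 (S u w))) (allFin n)))
                        (sum-allFin (λ u → ∑[ w < n ] 𝟙 (S u w)))

  edgeCount-reverse : (S : EdgeSet n) → edgeCount (reverse S) ≡ edgeCount S
  edgeCount-reverse S = begin
    edgeCount (reverse S)             ≡⟨ edgeCount-∑ (reverse S) ⟩
    ∑[ u < n ] ∑[ w < n ] 𝟙 (S w u)  ≡⟨ ∑-comm (λ u w → 𝟙 (S w u)) ⟩
    ∑[ w < n ] ∑[ u < n ] 𝟙 (S w u)  ≡⟨ edgeCount-∑ S ⟨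
    edgeCount S                       ∎
    where open ≡-Reasoning

  edgeCount-∨ : (S S' : EdgeSet n) → edgeCount (λ u w → S u w ∨ S' u w) ≤ edgeCount S + edgeCount S'
  edgeCount-∨ S S' = begin
    edgeCount (λ u w → S u w ∨ S' u w)
      ≡⟨ edgeCount-∑ _ ⟩
    ∑[ u < n ] ∑[ w < n ] 𝟙 (S u w ∨ S' u w)
      ≤⟨ ∑-mono-≤ (λ u → ∑-mono-≤ (λ w → 𝟙-∨ (S u w) (S' u w))) ⟩
    ∑[ u < n ] ∑[ w < n ] (𝟙 (S u w) + 𝟙 (S' u w))
      ≡⟨ sum-cong-≗ (λ u → ∑-distrib-+ (λ w → 𝟙 (S u w)) (λ w → 𝟙 (S' u w))) ⟩
    ∑[ u < n ] (out S u + out S' u)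
      ≡⟨ ∑-distrib-+ (out S) (out S') ⟩
    ∑[ u < n ] out S u + ∑[ u < n ] out S' u
      ≡⟨ cong₂ _+_ (edgeCount-∑ S) (edgeCount-∑ S') ⟨
    edgeCount S + edgeCount S'
      ∎
    where
    open ≤-Reasoning
    out : EdgeSet n → Fin n → ℕ
    out S u = ∑[ w < n ] 𝟙 (S u w)

  edgeCount-initialEv : (Tr Tv : EdgeSet n) → edgeCount (initialEv Tr Tv) ≤ edgeCount Tr + edgeCount Tv
  edgeCount-initialEv Tr Tv =
    subst (λ k → edgeCount (initialEv Tr Tv) ≤ edgeCount Tr + k) (edgeCount-reverse Tv) (edgeCount-∨ Tr (reverse Tv))

  edgeCount-addEdge : (S : EdgeSet n) (u w : Fin n) → edgeCount (addEdge S u w) ≤ edgeCount S + 1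
  edgeCount-addEdge S u w = begin
    edgeCount (addEdge S u w)                                     ≤⟨ edgeCount-∨ S arc ⟩
    edgeCount S + edgeCount arc                                    ≡⟨ cong (edgeCount S +_) (edgeCount-∑ arc) ⟩
    edgeCount S + ∑[ a < n ] ∑[ b < n ] 𝟙 (arc a b)                ≤⟨ +-monoʳ-≤ (edgeCount S) (∑-mono-≤ row) ⟩
    edgeCount S + ∑[ a < n ] 𝟙 (isYes (a ≟ u))                    ≡⟨ cong (edgeCount S +_) (∑-indicator u) ⟩
    edgeCount S + 1                                                 ∎
    where
    open ≤-Reasoning
    arc : EdgeSet n
    arc a b = isYes (a ≟ u) ∧ isYes (b ≟ w)
    row : ∀ a → ∑[ b < n ] 𝟙 (arc a b) ≤ 𝟙 (isYes (a ≟ u))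
    row a with isYes (a ≟ u)
    ... | true  = ≤-reflexive (∑-indicator w)
    ... | false = ≤-reflexive (sum-replicate-zero n)

  edgeCount-branching : (S : EdgeSet n) (r : Fin n) (p : Fin n → Fin n) →
                        (∀ u → ¬ T (S u r)) → (∀ {u w} → T (S u w) → u ≡ p w) → edgeCount S ≤ n ∸ 1
  edgeCount-branching S r p noneInto unique = m+n≤o⇒m≤o∸n (edgeCount S) (begin
    edgeCount S + 1                                               ≡⟨ cong₂ _+_ (edgeCount-∑ S) (sym (∑-indicator r)) ⟩
    ∑[ u < n ] ∑[ w < n ] 𝟙 (S u w) + ∑[ w < n ] 𝟙 (isYes (w ≟ r)) ≡⟨ cong (_+ _) (∑-comm (λ u w → 𝟙 (S u w))) ⟩
    ∑[ w < n ] inDegree w + ∑[ w < n ] 𝟙 (isYes (w ≟ r))           ≡⟨ ∑-distrib-+ inDegree _ ⟨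
    ∑[ w < n ] (inDegree w + 𝟙 (isYes (w ≟ r)))                     ≤⟨ ∑-mono-≤ column ⟩
    ∑[ w < n ] 1                                                    ≡⟨ ∑-const-1 n ⟩
    n                                                               ∎)
    where
    open ≤-Reasoning
    inDegree : Fin n → ℕ
    inDegree w = ∑[ u < n ] 𝟙 (S u w)
    column : ∀ w → inDegree w + 𝟙 (isYes (w ≟ r)) ≤ 1
    column w with w ≟ r
    ... | yes refl = +-monoˡ-≤ 1 (≤-trans (∑-mono-≤ (λ u → 𝟙-mono {c = false} (noneInto u)))
                                           (≤-reflexive (sum-replicate-zero n)))
    ... | no _     = ≤-trans (≤-reflexive (+-identityʳ (inDegree w)))
                     (≤-trans (∑-mono-≤ (λ u → 𝟙-mono {c = isYes (u ≟ p w)} (fromWitness ∘ unique)))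
                              (≤-reflexive (∑-indicator (p w))))

-- The loop of Algorithm A

module _ {n : ℕ} where

  addEdge-⊇ : ∀ (S : EdgeSet n) u w → S ⊆ᴱ addEdge S u w
  addEdge-⊇ S u w {a} {b} e = from (T-∨ {S a b}) (inj₁ e)

  addEdge-new : ∀ (S : EdgeSet n) u w → Arc (addEdge S u w) u w
  addEdge-new S u w =
    from (T-∨ {S u w}) (inj₂ (from T-∧ (fromWitness {a? = u ≟ u} refl , fromWitness {a? = w ≟ w} refl)))

module Run {n : ℕ} {E : EdgeSet n} {v : Fin n} {Tr Tv : EdgeSet n}
           (tree : SpanningTree E v Tr) (revTree : SpanningTree (reverse E) v Tv) where
  open TreeArcs tree

  ContainsTrees : EdgeSet n → Set
  ContainsTrees S = Tr ⊆ᴱ S × reverse Tv ⊆ᴱ S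

  reachVia : ∀ {S} → ContainsTrees S → ∀ a b → Path (Arc S) U a b
  reachVia (Tr⊆S , Tv⊆S) a b =
    reverseᵖ Tv⊆S (fromDPath (SpanningTree.spanning revTree a)) ++
    mapᵖ Tr⊆S id (fromDPath (SpanningTree.spanning tree b))

  Leader : EdgeSet n → Fin n → Set₁
  Leader S y = ∀ y' → toℕ y' < toℕ y → ¬ Same S y y'

  Leader-antimono : ∀ {S S'} → S ⊆ᴱ S' → ∀ {y} → Leader S' y → Leader S y
  Leader-antimono S⊆S' lead y' y'<y same = lead y' y'<y (Same-mono S⊆S' same)

  module WithTrees {S : EdgeSet n} (trees : ContainsTrees S) where
    open Spanned (proj₁ trees) (reachVia trees)

    Meets : ∀ {s t} → Fin n → Path (Arc S) U s t → Set₁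
    Meets y p = Σ[ B ∈ Block S y ] ShareTwo (members B) (onPath p)

    Clash : ∀ {s t} → Path (Arc S) U s t → Set₁
    Clash p = Σ[ y₁ ∈ Fin n ] Σ[ y₂ ∈ Fin n ] ¬ Same S y₁ y₂ × Meets y₁ p × Meets y₂ p

    meets : ∀ {y a b s t} (p : Path (Arc S) U s t) → InBlockOf S y a b → a ≢ b → a ∈ᵖ p → b ∈ᵖ p → Meets y p
    meets _ (B , a∈ , b∈) a≢b a∈p b∈p = B , _ , _ , a≢b , (a∈ , a∈p) , (b∈ , b∈p)

    chain : ∀ {s t} (p : Path (Arc S) U s t) → Simple p → s ≢ t → ¬ ¬ ((∃[ y ] InBlockOf S y s t) ⊎ Clash p)
    chain [ _ ] _ s≢t = ⊥-elim (s≢t refl)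
    chain (_ ∷⟨ st ⟩ [ _ ]) _ s≢t = pure (inj₁ (arcBlock s≢t st))
    chain {s} {t} whole@(_∷⟨_⟩_ {w = m} _ sm p@(_ ∷⟨ _ ⟩ p')) (s∉p ∷ sp@(m∉p' ∷ _)) _ = do
        rest ← chain p sp m≢t
        extend rest
      where
      s≢m : s ≢ m
      s≢m = lookup s∉p (here refl)
      m≢t : m ≢ t
      m≢t = lookup m∉p' (target∈ᵖ p')

      extend : (∃[ y' ] InBlockOf S y' m t) ⊎ Clash p → ¬ ¬ ((∃[ y ] InBlockOf S y s t) ⊎ Clash whole)
      extend (inj₂ (y₁ , y₂ , apart , (B₁ , sh₁) , (B₂ , sh₂))) =
        pure (inj₂ (y₁ , y₂ , apart , (B₁ , ShareTwo-mono id there sh₁) , (B₂ , ShareTwo-mono id there sh₂)))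
      extend (inj₁ (y' , later)) = do
          same? ← ¬¬-excluded-middle
          pure (decide (arcBlock s≢m sm) same?)
        where
        decide : (first : ∃[ y ] InBlockOf S y s m) → Dec (Same S (proj₁ first) y') →
                 (∃[ y ] InBlockOf S y s t) ⊎ Clash whole
        decide (y , first) (yes same) = inj₁ (y , glue first same later)
        decide (y , first) (no apart) = inj₂ (y , y' , apart ,
          meets whole first s≢m (here refl) (there (source∈ᵖ p)) ,
          meets whole later m≢t (there (source∈ᵖ p)) (there (target∈ᵖ p)))

    newArcMerges : ∀ {u w} → ¬ Together S u w →
                   ¬ ¬ (Σ[ y₁ ∈ Fin n ] Σ[ y₂ ∈ Fin n ] Same (addEdge S u w) y₁ y₂ × ¬ Same S y₁ y₂)
    newArcMerges {u} {w} apart = byCases (u ≟ w)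
      where
      S' = addEdge S u w
      back = shortcut (reachVia trees w u)
      q = proj₁ back

      cycle : StronglyBiconnectedSet S' (onPath q)
      cycle = StronglyBiconnectedSet-cycle (addEdge-⊇ S u w) (addEdge-new S u w) q (proj₂ back)

      conclude : (∃[ y ] InBlockOf S y w u) ⊎ Clash q →
                 ¬ ¬ (Σ[ y₁ ∈ Fin n ] Σ[ y₂ ∈ Fin n ] Same S' y₁ y₂ × ¬ Same S y₁ y₂)
      conclude (inj₁ (_ , B , w∈ , u∈)) = ⊥-elim (apart (members B , strong B , u∈ , w∈))
      conclude (inj₂ (y₁ , y₂ , wasApart , (B₁ , sh₁) , (B₂ , sh₂))) =
        pure (y₁ , y₂ , inj₂ (nonRoot B₂ , merged , inj₂ (head∈ B₂) , inj₂ (tail∈ B₂)) , wasApart)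
        where
        merged : Block S' y₁
        merged = Block-∪ (Block-∪ (Block-mono (addEdge-⊇ S u w) B₁) cycle sh₁)
                         (StronglyBiconnectedSet-mono (addEdge-⊇ S u w) (strong B₂))
                         (ShareTwo-mono inj₂ id (ShareTwo-sym sh₂))

      byCases : Dec (u ≡ w) → ¬ ¬ (Σ[ y₁ ∈ Fin n ] Σ[ y₂ ∈ Fin n ] Same S' y₁ y₂ × ¬ Same S y₁ y₂)
      byCases (yes refl) = ⊥-elim (apart (｛ u ｝ , StronglyBiconnectedSet-singleton u , refl , refl))
      byCases (no u≢w)   = do
        result ← chain q (proj₂ back) (u≢w ∘ sym)
        conclude result

    leaderOf : ∀ k y → toℕ y < k → ¬ ¬ (∃[ ℓ ] Leader S ℓ × Same S y ℓ)
    leaderOf (suc k) y y<k = do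
        leader? ← ¬¬-excluded-middle
        byCases leader?
      where
      byCases : Dec (Leader S y) → ¬ ¬ (∃[ ℓ ] Leader S ℓ × Same S y ℓ)
      byCases (yes lead) = pure (y , lead , Same-refl y)
      byCases (no notLead) = do
          (y' , y'<y , same) ← smaller
          (ℓ , lead , same') ← leaderOf k y' (<-≤-trans y'<y (≤-pred y<k))
          pure (ℓ , lead , Same-trans same same')
        where
        smaller : ¬ ¬ (Σ[ y' ∈ Fin n ] toℕ y' < toℕ y × Same S y y')
        smaller none = notLead λ y' y'<y same → none (y' , y'<y , same)

    leaderLost : ∀ {S' y₁ y₂} → S ⊆ᴱ S' → Same S' y₁ y₂ → ¬ Same S y₁ y₂ →
                 ¬ ¬ (∃[ z ] Leader S z × ¬ Leader S' z)
    leaderLost {S'} {y₁} {y₂} S⊆S' merged apart = do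
        (ℓ₁ , lead₁ , y₁~ℓ₁) ← leaderOf _ y₁ (toℕ<n y₁)
        (ℓ₂ , lead₂ , y₂~ℓ₂) ← leaderOf _ y₂ (toℕ<n y₂)
        let ℓ₁~ℓ₂ = Same-trans (Same-sym (Same-mono S⊆S' y₁~ℓ₁)) (Same-trans merged (Same-mono S⊆S' y₂~ℓ₂))
        compare ℓ₁ ℓ₂ y₁~ℓ₁ y₂~ℓ₂ lead₁ lead₂ ℓ₁~ℓ₂
      where
      compare : ∀ ℓ₁ ℓ₂ → Same S y₁ ℓ₁ → Same S y₂ ℓ₂ → Leader S ℓ₁ → Leader S ℓ₂ → Same S' ℓ₁ ℓ₂ →
                ¬ ¬ (∃[ z ] Leader S z × ¬ Leader S' z)
      compare ℓ₁ ℓ₂ y₁~ℓ₁ y₂~ℓ₂ lead₁ lead₂ ℓ₁~ℓ₂ with <-cmp (toℕ ℓ₁) (toℕ ℓ₂)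
      ... | tri< ℓ₁<ℓ₂ _ _ = pure (ℓ₂ , lead₂ , λ lead → lead ℓ₁ ℓ₁<ℓ₂ (Same-sym ℓ₁~ℓ₂))
      ... | tri> _ _ ℓ₂<ℓ₁ = pure (ℓ₁ , lead₁ , λ lead → lead ℓ₂ ℓ₂<ℓ₁ ℓ₁~ℓ₂)
      ... | tri≈ _ ℓ₁≡ℓ₂ _ rewrite toℕ-injective ℓ₁≡ℓ₂ =
        ⊥-elim (apart (Same-trans y₁~ℓ₁ (Same-sym y₂~ℓ₂)))

  ContainsTrees-addEdge : ∀ {S u w} → ContainsTrees S → ContainsTrees (addEdge S u w)
  ContainsTrees-addEdge {S} {u} {w} (Tr⊆S , Tv⊆S) = addEdge-⊇ S u w ∘ Tr⊆S , addEdge-⊇ S u w ∘ Tv⊆S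

  loopBound : ∀ {S Ev} → Loop E S Ev → ContainsTrees S → (L : Subset n) → Represents L (Leader S) →
              ¬ ¬ (edgeCount Ev + 1 ≤ edgeCount S + ∣ L ∣)
  loopBound {S} (done _) trees L rep = do
    (ℓ , lead , _) ← WithTrees.leaderOf trees _ v (toℕ<n v)
    pure (+-monoʳ-≤ (edgeCount S) (≤-trans (s≤s z≤n) (x∈p⇒∣p-x∣<∣p∣ (from (rep ℓ) lead))))
  loopBound {S} {Ev} (next {u = u} {w = w} _ _ _ apart rest) trees L rep = do
      (y₁ , y₂ , merged , wasApart) ← newArcMerges (λ together → together⇒sameComponent S together apart)
      (z , lead , notLead) ← leaderLost (addEdge-⊇ S u w) merged wasApart
      (L' , rep') ← realize (Leader S')
      bound ← loopBound rest (ContainsTrees-addEdge trees) L' rep'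
      pure (descend L' rep' (p⊂q⇒∣p∣<∣q∣ (fewerLeaders L' rep' z lead notLead)) bound)
    where
    open WithTrees trees
    S' = addEdge S u w

    fewerLeaders : ∀ L' → Represents L' (Leader S') → ∀ z → Leader S z → ¬ Leader S' z → L' ⊂ₛ L
    fewerLeaders L' rep' z lead notLead =
      (λ {y} y∈L' → from (rep y) (Leader-antimono (addEdge-⊇ S u w) (to (rep' y) y∈L'))) ,
      z , from (rep z) lead , notLead ∘ to (rep' z)

    descend : ∀ L' → Represents L' (Leader S') → ∣ L' ∣ < ∣ L ∣ →
              edgeCount Ev + 1 ≤ edgeCount S' + ∣ L' ∣ → edgeCount Ev + 1 ≤ edgeCount S + ∣ L ∣
    descend L' _ fewer bound = begin
      edgeCount Ev + 1          ≤⟨ bound ⟩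
      edgeCount S' + ∣ L' ∣     ≤⟨ +-monoˡ-≤ ∣ L' ∣ (edgeCount-addEdge S u w) ⟩
      edgeCount S + 1 + ∣ L' ∣  ≡⟨ +-assoc (edgeCount S) 1 ∣ L' ∣ ⟩
      edgeCount S + suc ∣ L' ∣  ≤⟨ +-monoʳ-≤ (edgeCount S) fewer ⟩
      edgeCount S + ∣ L ∣       ∎
      where open ≤-Reasoning

  initialContainsTrees : ContainsTrees (initialEv Tr Tv)
  initialContainsTrees = (λ {a} {b} e → from (T-∨ {Tr a b}) (inj₁ e)) ,
                         (λ {a} {b} e → from (T-∨ {Tr a b}) (inj₂ e))

  outputBound : ∀ {Ev} → Loop E (initialEv Tr Tv) Ev → ¬ ¬ (edgeCount Ev + 1 ≤ edgeCount (initialEv Tr Tv) + n)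
  outputBound loop = do
    (L , rep) ← realize (Leader (initialEv Tr Tv))
    bound ← loopBound loop initialContainsTrees L rep
    pure (≤-trans bound (+-monoʳ-≤ _ (∣p∣≤n L)))

spanningTree-edgeCount : ∀ {n} {E : EdgeSet n} {v Tr} → SpanningTree E v Tr → edgeCount Tr ≤ n ∸ 1
spanningTree-edgeCount {v = v} {Tr} tree =
  edgeCount-branching Tr v parent (SpanningTree.rootNoIn tree) parent-unique
  where open TreeArcs tree

three-budgets : ∀ e c m → e + 1 ≤ c + suc m → c ≤ m + m → e ≤ 3 * m
three-budgets e c m bound c≤2m = ≤-pred (begin
  suc e          ≡⟨ +-comm 1 e ⟩
  e + 1          ≤⟨ bound ⟩
  c + suc m      ≤⟨ +-monoˡ-≤ (suc m) c≤2m ⟩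
  m + m + suc m  ≡⟨ identity m ⟩
  suc (3 * m)    ∎)
  where
  open ≤-Reasoning
  identity : ∀ m → m + m + suc m ≡ suc (3 * m)
  identity = solve-∀

mainTheorem3 : (n : ℕ) (E : EdgeSet n) → StronglyBiconnected E →
    (Ev : EdgeSet n) → AlgorithmAOutput E Ev → edgeCount Ev ≤ 3 * (n ∸ 1)
mainTheorem3 zero    _ _ _  (() , _)
mainTheorem3 (suc m) _ _ Ev (_ , Tr , Tv , tree , revTree , loop) =
  decidable-stable (edgeCount Ev ≤? 3 * m)
    (¬¬-map (λ bound → three-budgets _ _ m bound initial≤2m) (outputBound loop))
  where
  open Run tree revTree
  initial≤2m : edgeCount (initialEv Tr Tv) ≤ m + m
  initial≤2m = ≤-trans (edgeCount-initialEv Tr Tv)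
                       (+-mono-≤ (spanningTree-edgeCount tree) (spanningTree-edgeCount revTree))
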